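{- Let a SetCover instance be given by sets $S_1,\dots,S_p$ whose union is a set of $l$ items, and let $k\ge1$ be an integer. Construct the graph $H$ with vertices $s_1,\dots,s_p$ (one per set), $u_1,\dots,u_l$ (one per item), two vertices $a,b$, and $x_1,\dots,x_{k+1}$, and edges: $u_j s_i$ whenever item $j\in S_i$; all pairs $s_is_{i'}$ (a $p$-clique); $a s_i$ for all $i$; $ab$; all pairs $x_jx_{j'}$ (a $(k+1)$-clique); and $bx_j$ for all $j$. Then there exists a set of at most $k$ non-edges of $H$ forming a matching whose addition reduces the diameter of $H$ to at most three if and only if the SetCover instance has a cover of size at most $k$ (i.e., at most $k$ of the sets whose union contains all $l$ items).
   Context: Graphs are simple, undirected, unweighted; the diameter is the maximum shortest-path distance over all vertex pairs. A set of added edges forms a matching if every vertex is incident to at most one of them. -}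

module Defs where

open import Data.Nat using (ℕ; zero; suc; _≤_)
open import Data.Fin using (Fin)
open import Data.Fin.Subset using (Subset; _∈_; ∣_∣)
open import Data.List using (List; []; _∷_; concatMap; length)
open import Data.List.Relation.Unary.All using (All)
open import Data.List.Relation.Unary.Unique.Propositional using (Unique)
import Data.List.Membership.Propositional as LM
open import Data.Product using (Σ; ∃; _×_; _,_)
open import Data.Sum using (_⊎_)
open import Data.Empty using (⊥)
open import Data.Unit using (⊤)
open import Relation.Binary.PropositionalEquality using (_≡_; _≢_)
open import Relation.Nullary using (¬_)

data V (p l k : ℕ) : Set where
  s : Fin p → V p l k
  u : Fin l → V p l k
  a : V p l k
  b : V p l k
  x : Fin (suc k) → V p l k

-- Edges of H, given the set system S : Fin p → Subset l
-- (item j belongs to S_i iff  j ∈ S i).  Listed in both orientations.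
data HAdj {p l k : ℕ} (S : Fin p → Subset l) : V p l k → V p l k → Set where
  us : ∀ {i j} → j ∈ S i → HAdj S (u j) (s i)
  su : ∀ {i j} → j ∈ S i → HAdj S (s i) (u j)
  ss : ∀ {i i'} → i ≢ i' → HAdj S (s i) (s i')
  as : ∀ {i} → HAdj S a (s i)
  sa : ∀ {i} → HAdj S (s i) a
  ab : HAdj S a b
  ba : HAdj S b a
  xx : ∀ {j j'} → j ≢ j' → HAdj S (x j) (x j')
  bx : ∀ {j} → HAdj S b (x j)
  xb : ∀ {j} → HAdj S (x j) b

endpoints : {A : Set} → List (A × A) → List A
endpoints = concatMap (λ { (v , w) → v ∷ w ∷ [] })

-- M is a matching consisting of non-edges of H: every listed pair is a
-- non-edge of H, and all endpoints are pairwise distinct (so no loops,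
-- no repeated edge, every vertex incident to at most one added edge).
IsNonEdgeMatching : {p l k : ℕ} (S : Fin p → Subset l) → List (V p l k × V p l k) → Set
IsNonEdgeMatching S M =
  All (λ { (v , w) → ¬ HAdj S v w }) M × Unique (endpoints M)

AdjPlus : {p l k : ℕ} (S : Fin p → Subset l) → List (V p l k × V p l k) →
          V p l k → V p l k → Set
AdjPlus S M v w = HAdj S v w ⊎ ((v , w) LM.∈ M ⊎ (w , v) LM.∈ M)

data WithinDist {A : Set} (E : A → A → Set) : ℕ → A → A → Set where
  here : ∀ {n v} → WithinDist E n v v
  step : ∀ {n v w z} → E v w → WithinDist E n w z → WithinDist E (suc n) v z

DiameterAtMost : {A : Set} → (A → A → Set) → ℕ → Set
DiameterAtMost {A} E d = (v w : A) → WithinDist E d v w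

IsCoverAtMost : {p l : ℕ} (S : Fin p → Subset l) → ℕ → Subset p → Set
IsCoverAtMost {p} {l} S k C =
  ∣ C ∣ ≤ k × ((j : Fin l) → Σ (Fin p) λ i → i ∈ C × j ∈ S i)

{-# OPTIONS --safe #-}
-- Every added edge has at most one x-endpoint (any two x's are already adjacent), so a
-- matching of at most k non-edges leaves some x_t unmatched.  A walk of length at most 3
-- from x_t to an item u_j must then use an added edge joining {x's, a, b} to u_j or to a
-- set containing j; the set side of the added edges is a cover with at most k sets.
-- Conversely, matching the sets of a cover to distinct x's brings every item within
-- distance 3 of every x, and all other distances in H are at most 3 already.
module Submission where

open import Defs
open import Data.Nat using (ℕ; suc; _+_; _≤_; _<_; z≤n; s≤s)
open import Data.Nat.Properties using (≤-trans; ≤-reflexive; n≤1+n; m⊓n≤m; +-suc; +-monoʳ-≤)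
open import Data.Fin using (Fin; zero; suc; _≟_)
open import Data.Fin.Properties using (pigeonhole; ¬∀⟶∃¬; suc-injective; <-irrefl)
open import Data.Fin.Subset using (Subset; _∈_; ∣_∣; ⁅_⁆; _∪_; ⋃; inside; outside)
open import Data.Fin.Subset.Properties using (x∈⁅x⁆; x∈p∪q⁺; ∣⁅x⁆∣≡1; ∣⊥∣≡0)
open import Data.Vec using (_∷_; []; here; there)
open import Data.List using (List; []; _∷_; length; map; mapMaybe; zipWith; allFin; lookup)
open import Data.List.Properties using (length-map; length-mapMaybe; length-zipWith; length-tabulate)
open import Data.List.Relation.Unary.Any using (here; there; index)
import Data.List.Relation.Unary.Any as Any
open import Data.List.Relation.Unary.Any.Properties as AnyProperties using (lookup-index)
open import Data.List.Relation.Unary.All as All using (_∷_; [])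
open import Data.List.Relation.Unary.AllPairs using (_∷_; [])
open import Data.List.Relation.Unary.Unique.Propositional using (Unique)
open import Data.List.Relation.Unary.Unique.Propositional.Properties using (map⁺; allFin⁺)
open import Data.List.Membership.Propositional using (_∉_) renaming (_∈_ to _∈ₗ_)
open import Data.List.Membership.Propositional.Properties using (∈-map⁺; ∈-map⁻)
import Data.List.Membership.DecPropositional as DecMembership
open import Data.Maybe using (Maybe; just; nothing; _<∣>_)
import Data.Maybe.Relation.Unary.Any as MaybeAny
open import Data.Product using (Σ; ∃; _×_; _,_; proj₁; proj₂)
open import Data.Sum using (_⊎_; inj₁; inj₂; swap)
open import Data.Empty using (⊥-elim)
open import Function using (_∘_)
open import Function.Bundles using (_⇔_; mk⇔)
open import Relation.Nullary using (¬_; yes; no)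
open import Relation.Binary.PropositionalEquality using (_≡_; _≢_; refl; sym; trans; cong; cong₂; subst)

∣p∪q∣≤∣p∣+∣q∣ : ∀ {n} (p q : Subset n) → ∣ p ∪ q ∣ ≤ ∣ p ∣ + ∣ q ∣
∣p∪q∣≤∣p∣+∣q∣ [] [] = z≤n
∣p∪q∣≤∣p∣+∣q∣ (outside ∷ p) (outside ∷ q) = ∣p∪q∣≤∣p∣+∣q∣ p q
∣p∪q∣≤∣p∣+∣q∣ (outside ∷ p) (inside ∷ q) =
  ≤-trans (s≤s (∣p∪q∣≤∣p∣+∣q∣ p q)) (≤-reflexive (sym (+-suc ∣ p ∣ ∣ q ∣)))
∣p∪q∣≤∣p∣+∣q∣ (inside ∷ p) (outside ∷ q) = s≤s (∣p∪q∣≤∣p∣+∣q∣ p q)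
∣p∪q∣≤∣p∣+∣q∣ (inside ∷ p) (inside ∷ q) =
  s≤s (≤-trans (∣p∪q∣≤∣p∣+∣q∣ p q) (+-monoʳ-≤ ∣ p ∣ (n≤1+n ∣ q ∣)))

fromList : ∀ {n} → List (Fin n) → Subset n
fromList is = ⋃ (map ⁅_⁆ is)

∣fromList∣≤length : ∀ {n} (is : List (Fin n)) → ∣ fromList is ∣ ≤ length is
∣fromList∣≤length {n} [] = ≤-reflexive (∣⊥∣≡0 n)
∣fromList∣≤length (i ∷ is) = ≤-trans (∣p∪q∣≤∣p∣+∣q∣ ⁅ i ⁆ (fromList is))
  (≤-trans (≤-reflexive (cong (_+ ∣ fromList is ∣) (∣⁅x⁆∣≡1 i))) (s≤s (∣fromList∣≤length is)))

∈-fromList⁺ : ∀ {n} {i : Fin n} {is} → i ∈ₗ is → i ∈ fromList is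
∈-fromList⁺ {i = i} (here refl) = x∈p∪q⁺ (inj₁ (x∈⁅x⁆ i))
∈-fromList⁺ (there i∈is) = x∈p∪q⁺ (inj₂ (∈-fromList⁺ i∈is))

elements : ∀ {n} → Subset n → List (Fin n)
elements [] = []
elements (inside ∷ p) = zero ∷ map suc (elements p)
elements (outside ∷ p) = map suc (elements p)

length-elements : ∀ {n} (p : Subset n) → length (elements p) ≡ ∣ p ∣
length-elements [] = refl
length-elements (inside ∷ p) = cong suc (trans (length-map suc (elements p)) (length-elements p))
length-elements (outside ∷ p) = trans (length-map suc (elements p)) (length-elements p)

∈-elements⁺ : ∀ {n} {i : Fin n} {p} → i ∈ p → i ∈ₗ elements p
∈-elements⁺ {p = inside ∷ p} here = here refl
∈-elements⁺ {p = inside ∷ p} (there i∈p) = there (∈-map⁺ suc (∈-elements⁺ i∈p))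
∈-elements⁺ {p = outside ∷ p} (there i∈p) = ∈-map⁺ suc (∈-elements⁺ i∈p)

elements-Unique : ∀ {n} (p : Subset n) → Unique (elements p)
elements-Unique [] = []
elements-Unique (inside ∷ p) = All.tabulate zero∉ ∷ map⁺ suc-injective (elements-Unique p)
  where
  zero∉ : ∀ {j} → j ∈ₗ map suc (elements p) → zero ≢ j
  zero∉ j∈ refl with ∈-map⁻ suc j∈
  ... | _ , _ , ()
elements-Unique (outside ∷ p) = map⁺ suc-injective (elements-Unique p)

∃-∉ : ∀ {n} (is : List (Fin n)) → length is < n → ∃ λ i → i ∉ is
∃-∉ {n} is |is|<n = ¬∀⟶∃¬ n (_∈ₗ is) (λ i → DecMembership._∈?_ _≟_ i is) all∈
  where
  all∈ : ¬ ((i : Fin n) → i ∈ₗ is)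
  all∈ ∈is with pigeonhole |is|<n (λ i → index (∈is i))
  ... | i , j , i<j , same-index = <-irrefl
    (trans (lookup-index (∈is i)) (trans (cong (lookup is) same-index) (sym (lookup-index (∈is j))))) i<j

∈-mapMaybe⁺ : ∀ {A B : Set} (f : A → Maybe B) {xs y z} → y ∈ₗ xs → f y ≡ just z → z ∈ₗ mapMaybe f xs
∈-mapMaybe⁺ f {xs} {y} {z} y∈xs fy≡z = AnyProperties.mapMaybe⁺ f xs (AnyProperties.map⁺ (Any.map just∈ y∈xs))
  where
  just∈ : ∀ {w} → y ≡ w → MaybeAny.Any (z ≡_) (f w)
  just∈ refl = subst (MaybeAny.Any (z ≡_)) (sym fy≡z) (MaybeAny.just refl)

module _ {A : Set} where

  Incident : A → A × A → Set
  Incident v (w , z) = w ≡ v ⊎ z ≡ v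

  MatchedTo : List (A × A) → A → A → Set
  MatchedTo M v w = (v , w) ∈ₗ M ⊎ (w , v) ∈ₗ M

  ∈-endpoints⁺ : ∀ {M e v} → e ∈ₗ M → Incident v e → v ∈ₗ endpoints M
  ∈-endpoints⁺ (here refl) (inj₁ refl) = here refl
  ∈-endpoints⁺ (here refl) (inj₂ refl) = there (here refl)
  ∈-endpoints⁺ {_ ∷ M} (there e∈M) v∈e = there (there (∈-endpoints⁺ {M} e∈M v∈e))

  ∈-endpoints⁻ : ∀ {M v} → v ∈ₗ endpoints M → ∃ λ e → e ∈ₗ M × Incident v e
  ∈-endpoints⁻ {(w , z) ∷ M} (here refl) = (w , z) , here refl , inj₁ refl
  ∈-endpoints⁻ {(w , z) ∷ M} (there (here refl)) = (w , z) , here refl , inj₂ refl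
  ∈-endpoints⁻ {_ ∷ M} (there (there v∈M)) with ∈-endpoints⁻ {M} v∈M
  ... | e , e∈M , v∈e = e , there e∈M , v∈e

  matched-endpoint : ∀ {M v w} → MatchedTo M v w → v ∈ₗ endpoints M
  matched-endpoint (inj₁ vw∈M) = ∈-endpoints⁺ vw∈M (inj₁ refl)
  matched-endpoint (inj₂ wv∈M) = ∈-endpoints⁺ wv∈M (inj₂ refl)

  incident-unique : ∀ {M e e′ v} → Unique (endpoints M) → e ∈ₗ M → e′ ∈ₗ M →
                    Incident v e → Incident v e′ → e ≡ e′
  incident-unique _ (here refl) (here refl) _ _ = refl
  incident-unique ((_ ∷ w∉) ∷ z∉ ∷ _) (here refl) (there e′∈M) v∈e v∈e′ with v∈e
  ... | inj₁ refl = ⊥-elim (All.lookup w∉ (∈-endpoints⁺ e′∈M v∈e′) refl)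
  ... | inj₂ refl = ⊥-elim (All.lookup z∉ (∈-endpoints⁺ e′∈M v∈e′) refl)
  incident-unique ((_ ∷ w∉) ∷ z∉ ∷ _) (there e∈M) (here refl) v∈e v∈e′ with v∈e′
  ... | inj₁ refl = ⊥-elim (All.lookup w∉ (∈-endpoints⁺ e∈M v∈e) refl)
  ... | inj₂ refl = ⊥-elim (All.lookup z∉ (∈-endpoints⁺ e∈M v∈e) refl)
  incident-unique (_ ∷ _ ∷ unique) (there e∈M) (there e′∈M) v∈e v∈e′ =
    incident-unique unique e∈M e′∈M v∈e v∈e′

  matched-unique : ∀ {M v w w′} → Unique (endpoints M) → MatchedTo M v w → MatchedTo M v w′ → w ≡ w′
  matched-unique unique (inj₁ m) (inj₁ m′) with incident-unique unique m m′ (inj₁ refl) (inj₁ refl)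
  ... | refl = refl
  matched-unique unique (inj₁ m) (inj₂ m′) with incident-unique unique m m′ (inj₁ refl) (inj₂ refl)
  ... | refl = refl
  matched-unique unique (inj₂ m) (inj₁ m′) with incident-unique unique m m′ (inj₂ refl) (inj₁ refl)
  ... | refl = refl
  matched-unique unique (inj₂ m) (inj₂ m′) with incident-unique unique m m′ (inj₂ refl) (inj₂ refl)
  ... | refl = refl

module _ {p l k : ℕ} (S : Fin p → Subset l) where

  Edge : Set
  Edge = V p l k × V p l k

  xIndex : V p l k → Maybe (Fin (suc k))
  xIndex (x t) = just t
  xIndex _ = nothing

  xIndexOfEdge : Edge → Maybe (Fin (suc k))
  xIndexOfEdge (v , w) = xIndex v <∣> xIndex w

  xIndexOfEdge-nonEdge : ∀ v {t} → ¬ HAdj S v (x t) → xIndexOfEdge (v , x t) ≡ just t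
  xIndexOfEdge-nonEdge (s _) _ = refl
  xIndexOfEdge-nonEdge (u _) _ = refl
  xIndexOfEdge-nonEdge a _ = refl
  xIndexOfEdge-nonEdge b _ = refl
  xIndexOfEdge-nonEdge (x t′) {t} ¬adj with t′ ≟ t
  ... | yes refl = refl
  ... | no t′≢t = ⊥-elim (¬adj (xx t′≢t))

  matched-x-index : ∀ {M t} → IsNonEdgeMatching S M → x t ∈ₗ endpoints M →
                    t ∈ₗ mapMaybe xIndexOfEdge M
  matched-x-index (nonEdges , _) xt∈M with ∈-endpoints⁻ xt∈M
  ... | _ , e∈M , inj₁ refl = ∈-mapMaybe⁺ xIndexOfEdge e∈M refl
  ... | (v , _) , e∈M , inj₂ refl =
    ∈-mapMaybe⁺ xIndexOfEdge e∈M (xIndexOfEdge-nonEdge v (All.lookup nonEdges e∈M))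

  unmatched-x : ∀ {M} → length M ≤ k → IsNonEdgeMatching S M → ∃ λ t → x t ∉ endpoints M
  unmatched-x {M} |M|≤k matching
    with ∃-∉ (mapMaybe xIndexOfEdge M) (s≤s (≤-trans (length-mapMaybe xIndexOfEdge M) |M|≤k))
  ... | t , t∉ = t , t∉ ∘ matched-x-index matching

  CoveredBy : List (Fin p) → Fin l → Set
  CoveredBy is j = ∃ λ i → i ∈ₗ is × j ∈ S i

  data Hub : V p l k → Set where
    hub-x : ∀ {t} → Hub (x t)
    hub-b : Hub b

  data Far : V p l k → Set where
    far-x : ∀ {t} → Far (x t)
    far-a : Far a
    far-b : Far b

  data Near (j : Fin l) : V p l k → Set where
    near-item : Near j (u j)
    near-set : ∀ {i} → j ∈ S i → Near j (s i)

  hub-far : ∀ {v} → Hub v → Far v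
  hub-far hub-x = far-x
  hub-far hub-b = far-b

  hub≢item : ∀ {v j} → Hub v → v ≢ u j
  hub≢item hub-x ()
  hub≢item hub-b ()

  x-neighbour-hub : ∀ {t w} → HAdj S (x t) w → Hub w
  x-neighbour-hub (xx _) = hub-x
  x-neighbour-hub xb = hub-b

  hub-neighbour-far : ∀ {v w} → Hub v → HAdj S v w → Far w
  hub-neighbour-far hub-x (xx _) = far-x
  hub-neighbour-far hub-x xb = far-b
  hub-neighbour-far hub-b ba = far-a
  hub-neighbour-far hub-b bx = far-x

  far-¬adjacent-item : ∀ {v j} → Far v → ¬ HAdj S v (u j)
  far-¬adjacent-item far-x ()
  far-¬adjacent-item far-a ()
  far-¬adjacent-item far-b ()

  adjacent-item-near : ∀ {v j} → HAdj S v (u j) → Near j v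
  adjacent-item-near (su j∈Si) = near-set j∈Si

  module _ (c : Fin l → Fin p) (c-covers : ∀ j → j ∈ S (c j)) where

    -- An item vertex stands for the chosen set c j containing it.
    setIndex : V p l k → Maybe (Fin p)
    setIndex (s i) = just i
    setIndex (u j) = just (c j)
    setIndex _ = nothing

    setIndexOfEdge : Edge → Maybe (Fin p)
    setIndexOfEdge (v , w) = setIndex v <∣> setIndex w

    coverOf : List Edge → List (Fin p)
    coverOf = mapMaybe setIndexOfEdge

    far-setIndex : ∀ {v} → Far v → setIndex v ≡ nothing
    far-setIndex far-x = refl
    far-setIndex far-a = refl
    far-setIndex far-b = refl

    near-setIndex : ∀ {j v} → Near j v → ∃ λ i → setIndex v ≡ just i × j ∈ S i
    near-setIndex {j} near-item = c j , refl , c-covers j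
    near-setIndex (near-set {i} j∈Si) = i , refl , j∈Si

    far-matched-near-covered : ∀ {M v w j} → Far v → MatchedTo M v w → Near j w →
                               CoveredBy (coverOf M) j
    far-matched-near-covered far (inj₁ vw∈M) near with near-setIndex near
    ... | i , w↦i , j∈Si = i , ∈-mapMaybe⁺ setIndexOfEdge vw∈M (cong₂ _<∣>_ (far-setIndex far) w↦i) , j∈Si
    far-matched-near-covered {v = v} far (inj₂ wv∈M) near with near-setIndex near
    ... | i , w↦i , j∈Si = i , ∈-mapMaybe⁺ setIndexOfEdge wv∈M (cong (_<∣> setIndex v) w↦i) , j∈Si

    hub-reaches-item : ∀ {M v j} → Unique (endpoints M) → Hub v →
                       WithinDist (AdjPlus S M) 2 v (u j) → CoveredBy (coverOf M) j
    hub-reaches-item _ () here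
    hub-reaches-item _ hub (step (inj₁ e) here) = ⊥-elim (far-¬adjacent-item (hub-far hub) e)
    hub-reaches-item _ hub (step (inj₂ m) here) = far-matched-near-covered (hub-far hub) m near-item
    hub-reaches-item _ hub (step (inj₁ e) (step (inj₁ e′) here)) =
      ⊥-elim (far-¬adjacent-item (hub-neighbour-far hub e) e′)
    hub-reaches-item _ hub (step (inj₁ e) (step (inj₂ m) here)) =
      far-matched-near-covered (hub-neighbour-far hub e) m near-item
    hub-reaches-item _ hub (step (inj₂ m) (step (inj₁ e) here)) =
      far-matched-near-covered (hub-far hub) m (adjacent-item-near e)
    hub-reaches-item unique hub (step (inj₂ m) (step (inj₂ m′) here)) =
      ⊥-elim (hub≢item hub (matched-unique unique (swap m) m′))

    unmatched-x-reaches-item : ∀ {M t j} → Unique (endpoints M) → x t ∉ endpoints M →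
                               WithinDist (AdjPlus S M) 3 (x t) (u j) → CoveredBy (coverOf M) j
    unmatched-x-reaches-item unique _ (step (inj₁ e) walk) = hub-reaches-item unique (x-neighbour-hub e) walk
    unmatched-x-reaches-item _ xt∉M (step (inj₂ m) _) = ⊥-elim (xt∉M (matched-endpoint m))

    matching⇒cover : ∀ {M} → length M ≤ k → IsNonEdgeMatching S M → DiameterAtMost (AdjPlus S M) 3 →
                     Σ (Subset p) λ C → IsCoverAtMost S k C
    matching⇒cover {M} |M|≤k matching@(_ , unique) diameter≤3 with unmatched-x |M|≤k matching
    ... | t , xt∉M = fromList (coverOf M) , |C|≤k , covers
      where
      |C|≤k : ∣ fromList (coverOf M) ∣ ≤ k
      |C|≤k = ≤-trans (∣fromList∣≤length (coverOf M)) (≤-trans (length-mapMaybe setIndexOfEdge M) |M|≤k)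
      covers : (j : Fin l) → Σ (Fin p) λ i → i ∈ fromList (coverOf M) × j ∈ S i
      covers j with unmatched-x-reaches-item unique xt∉M (diameter≤3 (x t) (u j))
      ... | i , i∈ , j∈Si = i , ∈-fromList⁺ i∈ , j∈Si

  CoverLinkedToX : List Edge → Set
  CoverLinkedToX M = (j : Fin l) → Σ (Fin p) λ i → j ∈ S i × Σ (Fin (suc k)) λ t → (s i , x t) ∈ₗ M

  module _ {M : List Edge} (linked : CoverLinkedToX M) where

    infixr 5 _▸_
    _▸_ : ∀ {n v w z} → HAdj S v w → WithinDist (AdjPlus S M) n w z → WithinDist (AdjPlus S M) (suc n) v z
    e ▸ walk = step (inj₁ e) walk

    setOf : Fin l → Fin p
    setOf j = proj₁ (linked j)

    ∈-setOf : ∀ j → j ∈ S (setOf j)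
    ∈-setOf j = proj₁ (proj₂ (linked j))

    from-s : ∀ i w → WithinDist (AdjPlus S M) 3 (s i) w
    from-s i (s i′) with i ≟ i′
    ... | yes refl = here
    ... | no i≢i′ = ss i≢i′ ▸ here
    from-s i (u j) with i ≟ setOf j
    ... | yes refl = su (∈-setOf j) ▸ here
    ... | no i≢ = ss i≢ ▸ su (∈-setOf j) ▸ here
    from-s i a = sa ▸ here
    from-s i b = sa ▸ ab ▸ here
    from-s i (x t) = sa ▸ ab ▸ bx ▸ here

    from-u : ∀ j w → WithinDist (AdjPlus S M) 3 (u j) w
    from-u j (s i) with setOf j ≟ i
    ... | yes refl = us (∈-setOf j) ▸ here
    ... | no ≢i = us (∈-setOf j) ▸ ss ≢i ▸ here
    from-u j (u j′) with setOf j ≟ setOf j′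
    ... | yes same = us (∈-setOf j) ▸ su (subst (j′ ∈_) (cong S (sym same)) (∈-setOf j′)) ▸ here
    ... | no ≢ = us (∈-setOf j) ▸ ss ≢ ▸ su (∈-setOf j′) ▸ here
    from-u j a = us (∈-setOf j) ▸ sa ▸ here
    from-u j b = us (∈-setOf j) ▸ sa ▸ ab ▸ here
    from-u j (x t) with linked j
    ... | i , j∈Si , t′ , m with t′ ≟ t
    ...   | yes refl = us j∈Si ▸ step (inj₂ (inj₁ m)) here
    ...   | no t′≢t = us j∈Si ▸ step (inj₂ (inj₁ m)) (xx t′≢t ▸ here)

    from-a : ∀ w → WithinDist (AdjPlus S M) 3 a w
    from-a (s i) = as ▸ here
    from-a (u j) = as ▸ su (∈-setOf j) ▸ here
    from-a a = here
    from-a b = ab ▸ here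
    from-a (x t) = ab ▸ bx ▸ here

    from-b : ∀ w → WithinDist (AdjPlus S M) 3 b w
    from-b (s i) = ba ▸ as ▸ here
    from-b (u j) = ba ▸ as ▸ su (∈-setOf j) ▸ here
    from-b a = ba ▸ here
    from-b b = here
    from-b (x t) = bx ▸ here

    from-x : ∀ t w → WithinDist (AdjPlus S M) 3 (x t) w
    from-x t (s i) = xb ▸ ba ▸ as ▸ here
    from-x t (u j) with linked j
    ... | i , j∈Si , t′ , m with t ≟ t′
    ...   | yes refl = step (inj₂ (inj₂ m)) (su j∈Si ▸ here)
    ...   | no t≢t′ = xx t≢t′ ▸ step (inj₂ (inj₂ m)) (su j∈Si ▸ here)
    from-x t a = xb ▸ ba ▸ here
    from-x t b = xb ▸ here
    from-x t (x t′) with t ≟ t′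
    ... | yes refl = here
    ... | no t≢t′ = xx t≢t′ ▸ here

    linked⇒diameter≤3 : DiameterAtMost (AdjPlus S M) 3
    linked⇒diameter≤3 (s i) = from-s i
    linked⇒diameter≤3 (u j) = from-u j
    linked⇒diameter≤3 a = from-a
    linked⇒diameter≤3 b = from-b
    linked⇒diameter≤3 (x t) = from-x t

  pairUp : List (Fin p) → List (Fin (suc k)) → List Edge
  pairUp = zipWith (λ i t → (s i , x t))

  length-pairUp : ∀ is ts → length (pairUp is ts) ≤ length is
  length-pairUp is ts = ≤-trans (≤-reflexive (length-zipWith _ is ts)) (m⊓n≤m (length is) (length ts))

  pairUp-links : ∀ {is ts i} → length is ≤ length ts → i ∈ₗ is →
                 ∃ λ t → (s i , x t) ∈ₗ pairUp is ts
  pairUp-links {_ ∷ _} {t ∷ _} _ (here refl) = t , here refl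
  pairUp-links {_ ∷ _} {_ ∷ _} (s≤s |is|≤|ts|) (there i∈is) with pairUp-links |is|≤|ts| i∈is
  ... | t , m = t , there m

  ∈-endpoints-pairUp : ∀ {is ts v} → v ∈ₗ endpoints (pairUp is ts) →
                       (∃ λ i → i ∈ₗ is × v ≡ s i) ⊎ (∃ λ t → t ∈ₗ ts × v ≡ x t)
  ∈-endpoints-pairUp {i ∷ _} {_ ∷ _} (here refl) = inj₁ (i , here refl , refl)
  ∈-endpoints-pairUp {_ ∷ _} {t ∷ _} (there (here refl)) = inj₂ (t , here refl , refl)
  ∈-endpoints-pairUp {_ ∷ is} {_ ∷ ts} (there (there v∈)) with ∈-endpoints-pairUp {is} {ts} v∈
  ... | inj₁ (i , i∈is , v≡si) = inj₁ (i , there i∈is , v≡si)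
  ... | inj₂ (t , t∈ts , v≡xt) = inj₂ (t , there t∈ts , v≡xt)

  pairUp-unique : ∀ {is ts} → Unique is → Unique ts → Unique (endpoints (pairUp is ts))
  pairUp-unique {[]} _ _ = []
  pairUp-unique {_ ∷ _} {[]} _ _ = []
  pairUp-unique {i ∷ is} {t ∷ ts} (i∉ ∷ unique-is) (t∉ ∷ unique-ts) =
    ((λ ()) ∷ All.tabulate s-fresh) ∷ All.tabulate x-fresh ∷ pairUp-unique unique-is unique-ts
    where
    s-fresh : ∀ {v} → v ∈ₗ endpoints (pairUp is ts) → s i ≢ v
    s-fresh v∈ refl with ∈-endpoints-pairUp {is} {ts} v∈
    ... | inj₁ (_ , i∈is , refl) = All.lookup i∉ i∈is refl
    x-fresh : ∀ {v} → v ∈ₗ endpoints (pairUp is ts) → x t ≢ v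
    x-fresh v∈ refl with ∈-endpoints-pairUp {is} {ts} v∈
    ... | inj₂ (_ , t∈ts , refl) = All.lookup t∉ t∈ts refl

  pairUp-matching : ∀ is ts → Unique (endpoints (pairUp is ts)) → IsNonEdgeMatching S (pairUp is ts)
  pairUp-matching [] _ unique = [] , unique
  pairUp-matching (_ ∷ _) [] unique = [] , unique
  pairUp-matching (_ ∷ is) (_ ∷ ts) unique@(_ ∷ _ ∷ unique′) =
    (λ ()) ∷ proj₁ (pairUp-matching is ts unique′) , unique

  cover⇒matching : ∀ {C} → IsCoverAtMost S k C →
                   Σ (List Edge) λ M → length M ≤ k × IsNonEdgeMatching S M × DiameterAtMost (AdjPlus S M) 3
  cover⇒matching {C} (|C|≤k , covers) =
    pairUp is ts ,
    ≤-trans (length-pairUp is ts) |is|≤k ,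
    pairUp-matching is ts (pairUp-unique (elements-Unique C) (allFin⁺ (suc k))) ,
    linked⇒diameter≤3 linked
    where
    is = elements C
    ts = allFin (suc k)
    |is|≤k : length is ≤ k
    |is|≤k = ≤-trans (≤-reflexive (length-elements C)) |C|≤k
    |is|≤|ts| : length is ≤ length ts
    |is|≤|ts| = ≤-trans |is|≤k (≤-trans (n≤1+n k) (≤-reflexive (sym (length-tabulate (λ t → t)))))
    linked : CoverLinkedToX (pairUp is ts)
    linked j with covers j
    ... | i , i∈C , j∈Si = i , j∈Si , pairUp-links |is|≤|ts| (∈-elements⁺ i∈C)

proposition3 : (p l k : ℕ) → 1 ≤ k → (S : Fin p → Subset l) →
    ((j : Fin l) → Σ (Fin p) λ i → j ∈ S i) →
    (Σ (List (V p l k × V p l k)) λ M →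
        length M ≤ k × IsNonEdgeMatching S M × DiameterAtMost (AdjPlus S M) 3)
    ⇔ (Σ (Subset p) λ C → IsCoverAtMost S k C)
proposition3 p l k _ S every-item-in-some-set =
  mk⇔ (λ { (M , |M|≤k , matching , diameter≤3) → matching⇒cover S c c-covers |M|≤k matching diameter≤3 })
      (λ { (C , cover) → cover⇒matching S cover })
  where
  c : Fin l → Fin p
  c j = proj₁ (every-item-in-some-set j)
  c-covers : ∀ j → j ∈ S (c j)
  c-covers j = proj₂ (every-item-in-some-set j)
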